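{- For every integer $n\ge 3$ there exists a hypergraph $H$ such that $\tau(H)=3$ and $\overrightarrow{\tau}(H)=n$.
   Context: A hypergraph $H$ consists of a finite vertex set $V(H)$ and a set $E(H)$ of hyperedges, each a nonempty subset of $V(H)$. A set cover of $H$ is a set of vertices intersecting every hyperedge; $\tau(H)$ is the minimum size of a set cover. For a bijection $\sigma: V(H)\to\{1,\dots,|V(H)|\}$ (an ordering), its cost is $\sum_{e\in E(H)}\min_{v\in e}\sigma(v)$. A minimum sum set cover of $H$ is an ordering of minimum cost. For an ordering $\sigma$, let $S_\sigma$ be the set of vertices $v$ with $\sigma(v)\le \max_{e\in E(H)}\min_{u\in e}\sigma(u)$. Define $\overrightarrow{\tau}(H)=\max\{|S_\sigma| : \sigma \text{ a minimum sum set cover of } H\}$. -}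

module Defs where

open import Data.Nat using (ℕ; zero; suc; _≤_; _≤?_; _⊔_; _⊓_)
open import Data.Fin using (Fin; toℕ)
open import Data.Fin.Subset using (Subset; _∈_; ∣_∣; Nonempty)
open import Data.Fin.Subset.Properties using (_∈?_)
open import Data.Fin.Permutation using (Permutation′; _⟨$⟩ʳ_)
open import Data.List using (List; foldr; map; length; filter; allFin)
open import Data.Nat.ListAction using (sum)
open import Relation.Binary.PropositionalEquality using (_≡_)
open import Data.List.Membership.Propositional as L using ()
open import Data.List.Relation.Unary.All using (All)
open import Data.List.Relation.Unary.Unique.Propositional using (Unique)
open import Data.Product using (Σ; ∃; _×_; _,_)
open import Relation.Nullary using (yes; no)

-- A hypergraph on the vertex set Fin nV: a duplicate-free list of
-- nonempty hyperedges (so E(H) is genuinely a set of nonempty subsets).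
record Hypergraph : Set where
  field
    nV       : ℕ
    edges    : List (Subset nV)
    nonempty : All Nonempty edges
    distinct : Unique edges
open Hypergraph public

IsSetCover : (H : Hypergraph) → Subset (nV H) → Set
IsSetCover H S = ∀ e → e L.∈ edges H → ∃ λ v → v ∈ e × v ∈ S

τ≡ : Hypergraph → ℕ → Set
τ≡ H k = (Σ (Subset (nV H)) λ S → IsSetCover H S × ∣ S ∣ ≡ k)
         × (∀ S → IsSetCover H S → k ≤ ∣ S ∣)

-- An ordering is a bijection V(H) → {1..|V(H)|}; σ(v) = 1 + position.
Ordering : Hypergraph → Set
Ordering H = Permutation′ (nV H)

pos : (H : Hypergraph) → Ordering H → Fin (nV H) → ℕ
pos H σ v = suc (toℕ (σ ⟨$⟩ʳ v))

-- min_{v ∈ e} σ(v)  (vertices outside e contribute the sentinel |V|+1,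
-- which never wins since hyperedges are nonempty)
hitTime : (H : Hypergraph) → Ordering H → Subset (nV H) → ℕ
hitTime H σ e = foldr (λ v acc → val v ⊓ acc) (suc (nV H)) (allFin (nV H))
  where
  val : Fin (nV H) → ℕ
  val v with v ∈? e
  ... | yes _ = pos H σ v
  ... | no  _ = suc (nV H)

cost : (H : Hypergraph) → Ordering H → ℕ
cost H σ = sum (map (hitTime H σ) (edges H))

IsMinSumSetCover : (H : Hypergraph) → Ordering H → Set
IsMinSumSetCover H σ = ∀ σ' → cost H σ ≤ cost H σ'

maxHit : (H : Hypergraph) → Ordering H → ℕ
maxHit H σ = foldr _⊔_ 0 (map (hitTime H σ) (edges H))

sizeS : (H : Hypergraph) → Ordering H → ℕ
sizeS H σ = length (filter (λ v → pos H σ v ≤? maxHit H σ) (allFin (nV H)))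

τ→≡ : Hypergraph → ℕ → Set
τ→≡ H k = (Σ (Ordering H) λ σ → IsMinSumSetCover H σ × sizeS H σ ≡ k)
          × (∀ σ → IsMinSumSetCover H σ → sizeS H σ ≤ k)

-- Take m core vertices and three leaves, and as hyperedges every set of core vertices together
-- with one leaf. The singleton hyperedges force every set cover to contain the three leaves, so
-- τ = 3. If an ordering gives the core vertices the ranks q and the leaves the ranks r, its cost is
-- the sum over the leaves j and the sets S of core vertices of min (r j, min of q over S). Lowering
-- every rank by one lowers the cost by (number of leaves) · 2 ^ (number of core vertices) and
-- removes the vertex of rank zero; as at most one vertex is removed per step, induction bounds the
-- cost below by (1 + 2 + 3) · 2 ^ m (this needs at most three leaves). Putting the core first and
-- the leaves last attains the bound, and that ordering hits the hyperedge made of the last leaf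
-- only with its last vertex, so τ→ = m + 3.

module Submission where

open import Defs
open import Data.Nat using (ℕ; zero; suc; _+_; _*_; _^_; _⊓_; _⊔_; _≤_; _<_; z≤n; s≤s)
open import Data.Nat.Properties
open import Data.Nat.ListAction using (sum)
open import Data.Nat.ListAction.Properties using (sum-++)
open import Data.Nat.Tactic.RingSolver using (solve-∀)
open import Data.Fin using (Fin; zero; suc; toℕ; fromℕ; _↑ˡ_; _↑ʳ_)
open import Data.Fin.Properties using (toℕ<n; toℕ-injective; toℕ-↑ˡ; toℕ-↑ʳ)
open import Data.Fin.Subset using (Subset; inside; outside; _∈_; _∉_; _⊆_; ⊥; ⊤; ⁅_⁆; ∣_∣)
open import Data.Fin.Subset.Properties using (_∈?_; drop-there; ∈⊤; x∈⁅x⁆; x∈⁅y⁆⇒x≡y; p⊆q⇒∣p∣≤∣q∣)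
open import Data.Fin.Permutation using (_⟨$⟩ʳ_)
import Data.Fin.Permutation as Permutation
open import Data.Vec using ([]; _∷_; here; there) renaming (_++_ to _++ᵛ_)
open import Data.Vec.Properties using (∷-injectiveʳ; ++-injectiveˡ; ++-injectiveʳ)
open import Data.List
  using (List; []; _∷_; _++_; map; foldr; tabulate; allFin; length; cartesianProductWith)
open import Data.List.Properties
  using (length-++; length-tabulate; length-filter; filter-all; map-++; map-∘; map-cong; map-tabulate;
         tabulate-cong; foldr-map)
import Data.List.Membership.Propositional as L
open import Data.List.Membership.Propositional.Properties
  using (∈-map⁺; ∈-map⁻; ∈-++⁺ˡ; ∈-++⁺ʳ; ∈-allFin; ∈-cartesianProductWith⁺; ∈-cartesianProductWith⁻)
open import Data.List.Relation.Unary.Any using (here; there)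
open import Data.List.Relation.Unary.All using (All; []; _∷_)
import Data.List.Relation.Unary.All.Properties as All
open import Data.List.Relation.Unary.AllPairs using ([]; _∷_)
open import Data.List.Relation.Unary.Unique.Propositional using (Unique)
import Data.List.Relation.Unary.Unique.Propositional.Properties as Unique
open import Data.Product using (Σ; ∃; _×_; _,_; proj₁; proj₂)
open import Data.Sum using (inj₁; inj₂)
open import Function using (_∘_; id)
open import Function.Bundles using (Injection)
open import Function.Properties.Inverse using (↔⇒↣)
open import Relation.Binary.PropositionalEquality
open import Relation.Nullary using (¬_; yes; no; contradiction)

-- The sum, over the 2 ^ length qs sublists S of qs, of the minimum of a and the entries of S.
sublistMinSum : ℕ → List ℕ → ℕ
sublistMinSum a []       = a
sublistMinSum a (q ∷ qs) = sublistMinSum a qs + sublistMinSum (a ⊓ q) qs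

sublistMinSums : List ℕ → List ℕ → ℕ
sublistMinSums as qs = sum (map (λ a → sublistMinSum a qs) as)

sublistMinSum-zero : ∀ qs → sublistMinSum 0 qs ≡ 0
sublistMinSum-zero []       = refl
sublistMinSum-zero (q ∷ qs) = cong₂ _+_ (sublistMinSum-zero qs) (sublistMinSum-zero qs)

sublistMinSum-suc : ∀ a qs →
  sublistMinSum (suc a) (map suc qs) ≡ 2 ^ length qs + sublistMinSum a qs
sublistMinSum-suc a []       = refl
sublistMinSum-suc a (q ∷ qs) = begin
  sublistMinSum (suc a) (map suc qs) + sublistMinSum (suc (a ⊓ q)) (map suc qs)
    ≡⟨ cong₂ _+_ (sublistMinSum-suc a qs) (sublistMinSum-suc (a ⊓ q) qs) ⟩
  (2 ^ length qs + sublistMinSum a qs) + (2 ^ length qs + sublistMinSum (a ⊓ q) qs)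
    ≡⟨ regroup (2 ^ length qs) (sublistMinSum a qs) (sublistMinSum (a ⊓ q) qs) ⟩
  2 ^ suc (length qs) + (sublistMinSum a qs + sublistMinSum (a ⊓ q) qs) ∎
  where
  open ≡-Reasoning
  regroup : ∀ x s t → (x + s) + (x + t) ≡ 2 * x + (s + t)
  regroup = solve-∀

sublistMinSums-suc : ∀ as qs →
  sublistMinSums (map suc as) (map suc qs) ≡ length as * 2 ^ length qs + sublistMinSums as qs
sublistMinSums-suc []       qs = refl
sublistMinSums-suc (a ∷ as) qs = begin
  sublistMinSum (suc a) (map suc qs) + sublistMinSums (map suc as) (map suc qs)
    ≡⟨ cong₂ _+_ (sublistMinSum-suc a qs) (sublistMinSums-suc as qs) ⟩
  (2 ^ length qs + sublistMinSum a qs) + (length as * 2 ^ length qs + sublistMinSums as qs)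
    ≡⟨ interchange (2 ^ length qs) _ _ _ ⟩
  (2 ^ length qs + length as * 2 ^ length qs) + (sublistMinSum a qs + sublistMinSums as qs) ∎
  where
  open ≡-Reasoning
  interchange : ∀ x s y t → (x + s) + (y + t) ≡ (x + y) + (s + t)
  interchange = solve-∀

decrements : List ℕ → List ℕ
decrements []           = []
decrements (zero  ∷ xs) = decrements xs
decrements (suc x ∷ xs) = x ∷ decrements xs

decrements-++ : ∀ xs ys → decrements (xs ++ ys) ≡ decrements xs ++ decrements ys
decrements-++ []           ys = refl
decrements-++ (zero  ∷ xs) ys = decrements-++ xs ys
decrements-++ (suc x ∷ xs) ys = cong (x ∷_) (decrements-++ xs ys)

decrements-map-suc : ∀ xs → decrements (map suc xs) ≡ xs
decrements-map-suc []       = refl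
decrements-map-suc (x ∷ xs) = cong (x ∷_) (decrements-map-suc xs)

decrements-< : ∀ {B xs} → All (_< suc B) xs → All (_< B) (decrements xs)
decrements-< {xs = []}         []               = []
decrements-< {xs = zero  ∷ xs} (_ ∷ xs<)        = decrements-< xs<
decrements-< {xs = suc x ∷ xs} (s≤s x<B ∷ xs<)  = x<B ∷ decrements-< xs<

decrements-≢ : ∀ {x xs} → All (suc x ≢_) xs → All (x ≢_) (decrements xs)
decrements-≢ {xs = []}         []         = []
decrements-≢ {xs = zero  ∷ xs} (_ ∷ ne)   = decrements-≢ ne
decrements-≢ {xs = suc y ∷ xs} (x≢y ∷ ne) = (x≢y ∘ cong suc) ∷ decrements-≢ ne

decrements-unique : ∀ {xs} → Unique xs → Unique (decrements xs)
decrements-unique {[]}         []         = []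
decrements-unique {zero  ∷ xs} (_ ∷ u)    = decrements-unique u
decrements-unique {suc x ∷ xs} (ne ∷ u)   = decrements-≢ ne ∷ decrements-unique u

length-decrements : ∀ xs → length (decrements xs) ≤ length xs
length-decrements []           = z≤n
length-decrements (zero  ∷ xs) = m≤n⇒m≤1+n (length-decrements xs)
length-decrements (suc x ∷ xs) = s≤s (length-decrements xs)

length-decrements-nonzero : ∀ {xs} → All (0 ≢_) xs → length (decrements xs) ≡ length xs
length-decrements-nonzero {[]}         []         = refl
length-decrements-nonzero {zero  ∷ xs} (0≢0 ∷ _)  = contradiction refl 0≢0
length-decrements-nonzero {suc x ∷ xs} (_ ∷ ne)   = cong suc (length-decrements-nonzero ne)

length-decrements-unique : ∀ {xs} → Unique xs → length xs ≤ suc (length (decrements xs))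
length-decrements-unique {[]}         []       = z≤n
length-decrements-unique {zero  ∷ xs} (ne ∷ _) = s≤s (≤-reflexive (sym (length-decrements-nonzero ne)))
length-decrements-unique {suc x ∷ xs} (_ ∷ u)  = s≤s (length-decrements-unique u)

sublistMinSum-decrements : ∀ a qs →
  sublistMinSum a qs ≡ sublistMinSum a (map suc (decrements qs))
sublistMinSum-decrements a []           = refl
sublistMinSum-decrements a (zero  ∷ qs) = begin
  sublistMinSum a qs + sublistMinSum (a ⊓ 0) qs
    ≡⟨ cong (λ b → sublistMinSum a qs + sublistMinSum b qs) (⊓-zeroʳ a) ⟩
  sublistMinSum a qs + sublistMinSum 0 qs       ≡⟨ cong (sublistMinSum a qs +_) (sublistMinSum-zero qs) ⟩
  sublistMinSum a qs + 0                        ≡⟨ +-identityʳ _ ⟩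
  sublistMinSum a qs                            ≡⟨ sublistMinSum-decrements a qs ⟩
  sublistMinSum a (map suc (decrements qs))     ∎
  where open ≡-Reasoning
sublistMinSum-decrements a (suc q ∷ qs) =
  cong₂ _+_ (sublistMinSum-decrements a qs) (sublistMinSum-decrements (a ⊓ suc q) qs)

sublistMinSums-decrements : ∀ as qs →
  sublistMinSums as qs ≡ sublistMinSums (map suc (decrements as)) (map suc (decrements qs))
sublistMinSums-decrements []           qs = refl
sublistMinSums-decrements (zero  ∷ as) qs =
  cong₂ _+_ (sublistMinSum-zero qs) (sublistMinSums-decrements as qs)
sublistMinSums-decrements (suc a ∷ as) qs =
  cong₂ _+_ (sublistMinSum-decrements (suc a) qs) (sublistMinSums-decrements as qs)

sublistMinSums-step : ∀ as qs →
  sublistMinSums (map suc as) (map suc qs) ≡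
  length as * 2 ^ length qs + sublistMinSums (map suc (decrements as)) (map suc (decrements qs))
sublistMinSums-step as qs =
  trans (sublistMinSums-suc as qs)
        (cong (length as * 2 ^ length qs +_) (sublistMinSums-decrements as qs))

triangular : ℕ → ℕ
triangular zero    = 0
triangular (suc l) = suc l + triangular l

triangular-mono-≤ : ∀ {l l'} → l ≤ l' → triangular l ≤ triangular l'
triangular-mono-≤ z≤n       = z≤n
triangular-mono-≤ (s≤s l≤l') = +-mono-≤ (s≤s l≤l') (triangular-mono-≤ l≤l')

triangular≤2* : ∀ {l} → l ≤ 3 → triangular l ≤ 2 * l
triangular≤2* {0} _ = z≤n
triangular≤2* {1} _ = s≤s z≤n
triangular≤2* {2} _ = s≤s (s≤s (s≤s z≤n))
triangular≤2* {3} _ = ≤-refl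
triangular≤2* {suc (suc (suc (suc _)))} (s≤s (s≤s (s≤s ())))

triangular≤+ : ∀ {l l'} → l ≤ suc l' → triangular l ≤ l + triangular l'
triangular≤+ {zero}  _            = z≤n
triangular≤+ {suc l} (s≤s l≤l') = +-monoʳ-≤ (suc l) (triangular-mono-≤ l≤l')

triangular-step-leaf : ∀ {l l'} X → l ≤ suc l' → triangular l * X ≤ l * X + triangular l' * X
triangular-step-leaf {l} {l'} X l≤1+l' = begin
  triangular l * X           ≤⟨ *-monoˡ-≤ X (triangular≤+ l≤1+l') ⟩
  (l + triangular l') * X    ≡⟨ *-distribʳ-+ X l (triangular l') ⟩
  l * X + triangular l' * X  ∎
  where open ≤-Reasoning

triangular-step-core : ∀ {l l'} k → l ≤ 3 → l ≤ l' →
  triangular l * 2 ^ suc k ≤ l * 2 ^ suc k + triangular l' * 2 ^ k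
triangular-step-core {l} {l'} k l≤3 l≤l' = begin
  triangular l * (2 * X)                 ≡⟨ split (triangular l) X ⟩
  triangular l * X + triangular l * X    ≤⟨ +-mono-≤ (*-monoˡ-≤ X (triangular≤2* l≤3))
                                                      (*-monoˡ-≤ X (triangular-mono-≤ l≤l')) ⟩
  2 * l * X + triangular l' * X          ≡⟨ cong (_+ triangular l' * X) (regroup l X) ⟩
  l * (2 * X) + triangular l' * X        ∎
  where
  open ≤-Reasoning
  X : ℕ
  X = 2 ^ k
  split : ∀ t x → t * (2 * x) ≡ t * x + t * x
  split = solve-∀
  regroup : ∀ t x → 2 * t * x ≡ t * (2 * x)
  regroup = solve-∀

-- The last hypothesis says that at most one of the k + l entries was lost, so either
-- k = suc k' and l' = l, or k' = k.
triangular-step : ∀ {k k' l l'} → l ≤ 3 → k' ≤ k → l' ≤ l → k + l ≤ suc (k' + l') →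
  triangular l * 2 ^ k ≤ l * 2 ^ k + triangular l' * 2 ^ k'
triangular-step {k} {k'} {l} {l'} l≤3 k'≤k l'≤l lost≤1 with m≤n⇒m<n∨m≡n k'≤k
... | inj₂ refl =
  triangular-step-leaf (2 ^ k)
    (+-cancelˡ-≤ k l (suc l') (≤-trans lost≤1 (≤-reflexive (sym (+-suc k l')))))
... | inj₁ k'<k =
  subst (λ k → triangular l * 2 ^ k ≤ l * 2 ^ k + triangular l' * 2 ^ k')
        (≤-antisym k'<k k≤1+k') (triangular-step-core k' l≤3 l≤l')
  where
  l≤l' : l ≤ l'
  l≤l' = +-cancelˡ-≤ (suc k') l l' (≤-trans (+-monoˡ-≤ l k'<k) lost≤1)
  k≤1+k' : k ≤ suc k'
  k≤1+k' = +-cancelʳ-≤ l k (suc k') (≤-trans lost≤1 (s≤s (+-monoʳ-≤ k' l'≤l)))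

-- Induction on the bound B: one unit is taken off every value, which costs
-- length as * 2 ^ length qs, and the value that becomes zero drops out.
sublistMinSums-lowerBound : ∀ B as qs → length as ≤ 3 → All (_< B) (qs ++ as) → Unique (qs ++ as) →
  triangular (length as) * 2 ^ length qs ≤ sublistMinSums (map suc as) (map suc qs)
sublistMinSums-lowerBound zero []       qs _ _ _ = z≤n
sublistMinSums-lowerBound zero (a ∷ as) qs _ bounded _ with All.++⁻ʳ qs bounded
... | () ∷ _
sublistMinSums-lowerBound (suc B) as qs l≤3 bounded distinct = begin
  triangular l * 2 ^ k
    ≤⟨ triangular-step l≤3 (length-decrements qs) (length-decrements as) lost≤1 ⟩
  l * 2 ^ k + triangular (length as') * 2 ^ length qs'
    ≤⟨ +-monoʳ-≤ (l * 2 ^ k) (sublistMinSums-lowerBound B as' qs'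
          (≤-trans (length-decrements as) l≤3)
          (subst (All (_< B)) split (decrements-< bounded))
          (subst Unique split (decrements-unique distinct))) ⟩
  l * 2 ^ k + sublistMinSums (map suc as') (map suc qs')
    ≡⟨ sym (sublistMinSums-step as qs) ⟩
  sublistMinSums (map suc as) (map suc qs) ∎
  where
  open ≤-Reasoning
  l k : ℕ
  l = length as
  k = length qs
  as' qs' : List ℕ
  as' = decrements as
  qs' = decrements qs
  split : decrements (qs ++ as) ≡ qs' ++ as'
  split = decrements-++ qs as
  lost≤1 : k + l ≤ suc (length qs' + length as')
  lost≤1 = begin
    k + l                             ≡⟨ length-++ qs ⟨
    length (qs ++ as)                 ≤⟨ length-decrements-unique distinct ⟩
    suc (length (decrements (qs ++ as))) ≡⟨ cong (suc ∘ length) split ⟩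
    suc (length (qs' ++ as'))         ≡⟨ cong suc (length-++ qs') ⟩
    suc (length qs' + length as')     ∎

sublistMinSums-consecutive : ∀ k →
  sublistMinSums (map suc (tabulate {n = 3} (λ j → k + toℕ j))) (map suc (tabulate {n = k} toℕ))
  ≡ 6 * 2 ^ k
sublistMinSums-consecutive zero    = refl
sublistMinSums-consecutive (suc k) = begin
  sublistMinSums (map suc leaves) (map suc core)
    ≡⟨ sublistMinSums-step leaves core ⟩
  3 * 2 ^ length core + sublistMinSums (map suc (decrements leaves)) (map suc (decrements core))
    ≡⟨ cong₂ (λ c d → 3 * 2 ^ c + sublistMinSums (map suc (decrements leaves)) (map suc d))
             (length-tabulate {n = suc k} toℕ) core-decrements ⟩
  3 * 2 ^ suc k +
  sublistMinSums (map suc (tabulate {n = 3} (λ j → k + toℕ j))) (map suc (tabulate {n = k} toℕ))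
    ≡⟨ cong (3 * 2 ^ suc k +_) (sublistMinSums-consecutive k) ⟩
  3 * (2 * 2 ^ k) + 6 * 2 ^ k
    ≡⟨ regroup (2 ^ k) ⟩
  6 * 2 ^ suc k ∎
  where
  open ≡-Reasoning
  leaves core : List ℕ
  leaves = tabulate {n = 3} (λ j → suc k + toℕ j)
  core = tabulate {n = suc k} toℕ
  core-decrements : decrements core ≡ tabulate {n = k} toℕ
  core-decrements =
    trans (cong decrements (sym (map-tabulate {n = k} toℕ suc))) (decrements-map-suc (tabulate toℕ))
  regroup : ∀ x → 3 * (2 * x) + 6 * x ≡ 6 * (2 * x)
  regroup = solve-∀

minOn : ∀ {n} → Subset n → (Fin n → ℕ) → ℕ → ℕ
minOn []            w d = d
minOn (outside ∷ S) w d = minOn S (w ∘ suc) d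
minOn (inside  ∷ S) w d = w zero ⊓ minOn S (w ∘ suc) d

minOn≤ : ∀ {n} (S : Subset n) w d → minOn S w d ≤ d
minOn≤ []            w d = ≤-refl
minOn≤ (outside ∷ S) w d = minOn≤ S (w ∘ suc) d
minOn≤ (inside  ∷ S) w d = ≤-trans (m⊓n≤n (w zero) _) (minOn≤ S (w ∘ suc) d)

minOn-⊥ : ∀ n w d → minOn (⊥ {n}) w d ≡ d
minOn-⊥ zero    w d = refl
minOn-⊥ (suc n) w d = minOn-⊥ n (w ∘ suc) d

minOn-⁅⁆ : ∀ {n} (j : Fin n) w d → w j ≤ d → minOn ⁅ j ⁆ w d ≡ w j
minOn-⁅⁆ {suc n} zero    w d wj≤d = trans (cong (w zero ⊓_) (minOn-⊥ n (w ∘ suc) d)) (m≤n⇒m⊓n≡m wj≤d)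
minOn-⁅⁆         (suc j) w d wj≤d = minOn-⁅⁆ j (w ∘ suc) d wj≤d

minOn-++ : ∀ {m n} (S : Subset m) (T : Subset n) w d →
  minOn (S ++ᵛ T) w d ≡ minOn S (w ∘ (_↑ˡ n)) d ⊓ minOn T (w ∘ (m ↑ʳ_)) d
minOn-++ []            T w d = sym (m≥n⇒m⊓n≡n (minOn≤ T w d))
minOn-++ (outside ∷ S) T w d = minOn-++ S T (w ∘ suc) d
minOn-++ (inside  ∷ S) T w d =
  trans (cong (w zero ⊓_) (minOn-++ S T (w ∘ suc) d)) (sym (⊓-assoc (w zero) _ _))

foldr-⊓-tabulate : ∀ {n} (S : Subset n) (w val : Fin n → ℕ) d →
  (∀ {v} → v ∈ S → val v ≡ w v) → (∀ {v} → v ∉ S → val v ≡ d) →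
  foldr _⊓_ d (tabulate val) ≡ minOn S w d
foldr-⊓-tabulate []            w val d on off = refl
foldr-⊓-tabulate (outside ∷ S) w val d on off =
  trans (cong₂ _⊓_ (off λ ())
          (foldr-⊓-tabulate S (w ∘ suc) (val ∘ suc) d (on ∘ there) (λ v∉S → off (v∉S ∘ drop-there))))
        (m≥n⇒m⊓n≡n (minOn≤ S (w ∘ suc) d))
foldr-⊓-tabulate (inside ∷ S) w val d on off =
  cong₂ _⊓_ (on here)
    (foldr-⊓-tabulate S (w ∘ suc) (val ∘ suc) d (on ∘ there) (λ v∉S → off (v∉S ∘ drop-there)))

-- Names the local function in the definition of hitTime, so that it can be analysed by v ∈? e.
private
  hitTime-unfolded : ∀ H σ e → Σ (Fin (nV H) → ℕ) λ val →
    hitTime H σ e ≡ foldr (λ v acc → val v ⊓ acc) (suc (nV H)) (allFin (nV H))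
  hitTime-unfolded H σ e = _ , refl

hitTime≡minOn : ∀ H σ e → hitTime H σ e ≡ minOn e (pos H σ) (suc (nV H))
hitTime≡minOn H σ e = begin
  hitTime H σ e
    ≡⟨ proj₂ unfolded ⟩
  foldr (λ v acc → val v ⊓ acc) (suc (nV H)) (allFin (nV H))
    ≡⟨ foldr-map _⊓_ val (suc (nV H)) (allFin (nV H)) ⟨
  foldr _⊓_ (suc (nV H)) (map val (allFin (nV H)))
    ≡⟨ cong (foldr _⊓_ (suc (nV H))) (map-tabulate id val) ⟩
  foldr _⊓_ (suc (nV H)) (tabulate val)
    ≡⟨ foldr-⊓-tabulate e (pos H σ) val _ on off ⟩
  minOn e (pos H σ) (suc (nV H)) ∎
  where
  open ≡-Reasoning
  unfolded : Σ (Fin (nV H) → ℕ) λ val →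
    hitTime H σ e ≡ foldr (λ v acc → val v ⊓ acc) (suc (nV H)) (allFin (nV H))
  unfolded = hitTime-unfolded H σ e
  val : Fin (nV H) → ℕ
  val = proj₁ unfolded
  on : ∀ {v} → v ∈ e → val v ≡ pos H σ v
  on {v} v∈e with v ∈? e
  ... | yes _   = refl
  ... | no v∉e = contradiction v∈e v∉e
  off : ∀ {v} → v ∉ e → val v ≡ suc (nV H)
  off {v} v∉e with v ∈? e
  ... | yes v∈e = contradiction v∈e v∉e
  ... | no _    = refl

allSubsets : ∀ n → List (Subset n)
allSubsets zero    = [] ∷ []
allSubsets (suc n) = map (outside ∷_) (allSubsets n) ++ map (inside ∷_) (allSubsets n)

∈-allSubsets : ∀ {n} (S : Subset n) → S L.∈ allSubsets n
∈-allSubsets []            = here refl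
∈-allSubsets (outside ∷ S) = ∈-++⁺ˡ (∈-map⁺ (outside ∷_) (∈-allSubsets S))
∈-allSubsets (inside  ∷ S) = ∈-++⁺ʳ _ (∈-map⁺ (inside ∷_) (∈-allSubsets S))

allSubsets-unique : ∀ n → Unique (allSubsets n)
allSubsets-unique zero    = [] ∷ []
allSubsets-unique (suc n) = Unique.++⁺ (Unique.map⁺ ∷-injectiveʳ u) (Unique.map⁺ ∷-injectiveʳ u) disjoint
  where
  u : Unique (allSubsets n)
  u = allSubsets-unique n
  disjoint : ∀ {S} → ¬ (S L.∈ map (outside ∷_) (allSubsets n) × S L.∈ map (inside ∷_) (allSubsets n))
  disjoint (S∈out , S∈in) with ∈-map⁻ (outside ∷_) S∈out | ∈-map⁻ (inside ∷_) S∈in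
  ... | _ , _ , refl | _ , _ , ()

sum-map-++ : ∀ {A : Set} (f : A → ℕ) xs ys → sum (map f (xs ++ ys)) ≡ sum (map f xs) + sum (map f ys)
sum-map-++ f xs ys = trans (cong sum (map-++ f xs ys)) (sum-++ (map f xs) (map f ys))

sum-minOn-allSubsets : ∀ {n} (w : Fin n → ℕ) d a → a ≤ d →
  sum (map (λ S → minOn S w d ⊓ a) (allSubsets n)) ≡ sublistMinSum a (tabulate w)
sum-minOn-allSubsets {zero}  w d a a≤d = trans (+-identityʳ (d ⊓ a)) (m≥n⇒m⊓n≡n a≤d)
sum-minOn-allSubsets {suc n} w d a a≤d = begin
  sum (map f (map (outside ∷_) A ++ map (inside ∷_) A))
    ≡⟨ sum-map-++ f (map (outside ∷_) A) (map (inside ∷_) A) ⟩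
  sum (map f (map (outside ∷_) A)) + sum (map f (map (inside ∷_) A))
    ≡⟨ cong₂ _+_ (cong sum (map-∘ A)) (cong sum (map-∘ A)) ⟨
  sum (map (λ S → minOn S w' d ⊓ a) A) + sum (map (λ S → (w zero ⊓ minOn S w' d) ⊓ a) A)
    ≡⟨ cong (sum (map (λ S → minOn S w' d ⊓ a) A) +_)
            (cong sum (map-cong (λ S → reassoc (w zero) (minOn S w' d)) A)) ⟩
  sum (map (λ S → minOn S w' d ⊓ a) A) + sum (map (λ S → minOn S w' d ⊓ (a ⊓ w zero)) A)
    ≡⟨ cong₂ _+_ (sum-minOn-allSubsets w' d a a≤d)
                 (sum-minOn-allSubsets w' d (a ⊓ w zero) (≤-trans (m⊓n≤m a (w zero)) a≤d)) ⟩
  sublistMinSum a (tabulate w') + sublistMinSum (a ⊓ w zero) (tabulate w') ∎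
  where
  open ≡-Reasoning
  A : List (Subset n)
  A = allSubsets n
  w' : Fin n → ℕ
  w' = w ∘ suc
  f : Subset (suc n) → ℕ
  f S = minOn S w d ⊓ a
  reassoc : ∀ x y → (x ⊓ y) ⊓ a ≡ y ⊓ (a ⊓ x)
  reassoc x y = trans (cong (_⊓ a) (⊓-comm x y)) (trans (⊓-assoc y x a) (cong (y ⊓_) (⊓-comm x a)))

pos≤nV : ∀ H σ v → pos H σ v ≤ nV H
pos≤nV H σ v = toℕ<n (σ ⟨$⟩ʳ v)

≤-foldr-⊔ : ∀ {x} xs → x L.∈ xs → x ≤ foldr _⊔_ 0 xs
≤-foldr-⊔ (y ∷ ys) (here refl) = m≤m⊔n y _
≤-foldr-⊔ (y ∷ ys) (there x∈ys) = ≤-trans (≤-foldr-⊔ ys x∈ys) (m≤n⊔m y _)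

hitTime≤maxHit : ∀ H σ {e} → e L.∈ edges H → hitTime H σ e ≤ maxHit H σ
hitTime≤maxHit H σ e∈E = ≤-foldr-⊔ _ (∈-map⁺ (hitTime H σ) e∈E)

sizeS≤nV : ∀ H σ → sizeS H σ ≤ nV H
sizeS≤nV H σ = ≤-trans (length-filter (λ v → pos H σ v ≤? maxHit H σ) (allFin (nV H)))
                       (≤-reflexive (length-tabulate id))

sizeS≡nV : ∀ H σ → nV H ≤ maxHit H σ → sizeS H σ ≡ nV H
sizeS≡nV H σ late =
  trans (cong length (filter-all (λ v → pos H σ v ≤? maxHit H σ)
                                 (All.tabulate⁺ (λ v → ≤-trans (pos≤nV H σ v) late))))
        (length-tabulate id)

τ→≡nV : ∀ H (σ : Ordering H) → IsMinSumSetCover H σ → nV H ≤ maxHit H σ → τ→≡ H (nV H)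
τ→≡nV H σ optimal late = (σ , optimal , sizeS≡nV H σ late) , λ σ' _ → sizeS≤nV H σ'

tabulate-++ : ∀ {A : Set} m {n} (f : Fin (m + n) → A) →
  tabulate f ≡ tabulate (f ∘ (_↑ˡ n)) ++ tabulate (f ∘ (m ↑ʳ_))
tabulate-++ zero    f = refl
tabulate-++ (suc m) f = cong (f zero ∷_) (tabulate-++ m (f ∘ suc))

sum-map-cartesianProductWith : ∀ {A B C : Set} (h : C → ℕ) (f : A → B → C) xs ys →
  sum (map h (cartesianProductWith f xs ys)) ≡ sum (map (λ x → sum (map (h ∘ f x) ys)) xs)
sum-map-cartesianProductWith h f []       ys = refl
sum-map-cartesianProductWith h f (x ∷ xs) ys =
  trans (sum-map-++ h (map (f x) ys) (cartesianProductWith f xs ys))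
        (cong₂ _+_ (cong sum (sym (map-∘ ys))) (sum-map-cartesianProductWith h f xs ys))

⁅⁆-injective : ∀ {n} {i j : Fin n} → ⁅ i ⁆ ≡ ⁅ j ⁆ → i ≡ j
⁅⁆-injective {i = i} {j} eq = x∈⁅y⁆⇒x≡y j (subst (i ∈_) eq (x∈⁅x⁆ i))

↑ʳ∈++ : ∀ {m n} (S : Subset m) {T : Subset n} {j} → j ∈ T → (m ↑ʳ j) ∈ S ++ᵛ T
↑ʳ∈++ []      j∈T = j∈T
↑ʳ∈++ (_ ∷ S) j∈T = there (↑ʳ∈++ S j∈T)

∈-⊥++⁻ : ∀ m {n} {T : Subset n} {v} → v ∈ ⊥ {m} ++ᵛ T → ∃ λ j → v ≡ m ↑ʳ j × j ∈ T
∈-⊥++⁻ zero    v∈T        = _ , refl , v∈T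
∈-⊥++⁻ (suc m) (there v∈) with ∈-⊥++⁻ m v∈
... | j , refl , j∈T = j , refl , j∈T

∣⊥++∣ : ∀ m {n} (T : Subset n) → ∣ ⊥ {m} ++ᵛ T ∣ ≡ ∣ T ∣
∣⊥++∣ zero    T = refl
∣⊥++∣ (suc m) T = ∣⊥++∣ m T

-- The vertices i ↑ˡ 3 form the core and the vertices m ↑ʳ j are the three leaves.
edge : ∀ {m} → Fin 3 → Subset m → Subset (m + 3)
edge j S = S ++ᵛ ⁅ j ⁆

edge-injective : ∀ {m i j} {S T : Subset m} → edge i S ≡ edge j T → i ≡ j × S ≡ T
edge-injective {S = S} {T} eq = ⁅⁆-injective (++-injectiveʳ S T eq) , ++-injectiveˡ S T eq

leaf∈edge : ∀ {m} j (S : Subset m) → (m ↑ʳ j) ∈ edge j S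
leaf∈edge j S = ↑ʳ∈++ S (x∈⁅x⁆ j)

hypergraph : ℕ → Hypergraph
hypergraph m = record
  { nV       = m + 3
  ; edges    = cartesianProductWith edge (allFin 3) (allSubsets m)
  ; nonempty = All.cartesianProductWith⁺ (setoid _) (setoid _) edge (allFin 3) (allSubsets m)
                 (λ {j} {S} _ _ → m ↑ʳ j , leaf∈edge j S)
  ; distinct = Unique.cartesianProductWith⁺ edge edge-injective (Unique.allFin⁺ 3) (allSubsets-unique m)
  }

edge∈edges : ∀ {m} j (S : Subset m) → edge j S L.∈ edges (hypergraph m)
edge∈edges j S = ∈-cartesianProductWith⁺ edge (∈-allFin j) (∈-allSubsets S)

leaves : ∀ m → Subset (m + 3)
leaves m = ⊥ {m} ++ᵛ ⊤

leaves-cover : ∀ m → IsSetCover (hypergraph m) (leaves m)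
leaves-cover m e e∈E with ∈-cartesianProductWith⁻ edge (allFin 3) (allSubsets m) e∈E
... | j , S , _ , _ , refl = m ↑ʳ j , leaf∈edge j S , ↑ʳ∈++ (⊥ {m}) ∈⊤

leaves⊆cover : ∀ m {C} → IsSetCover (hypergraph m) C → leaves m ⊆ C
leaves⊆cover m cover v∈leaves with ∈-⊥++⁻ m v∈leaves
... | j , refl , _ with cover (edge j (⊥ {m})) (edge∈edges j ⊥)
...   | v , v∈edge , v∈C with ∈-⊥++⁻ m v∈edge
...     | i , refl , i∈⁅j⁆ with x∈⁅y⁆⇒x≡y j i∈⁅j⁆
...       | refl = v∈C

τ≡3 : ∀ m → τ≡ (hypergraph m) 3
τ≡3 m = (leaves m , leaves-cover m , ∣⊥++∣ m (⊤ {3})) ,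
        λ C cover → subst (_≤ ∣ C ∣) (∣⊥++∣ m (⊤ {3})) (p⊆q⇒∣p∣≤∣q∣ (leaves⊆cover m cover))

module _ {m} (σ : Ordering (hypergraph m)) where
  private
    H : Hypergraph
    H = hypergraph m

  rank : Fin (m + 3) → ℕ
  rank v = toℕ (σ ⟨$⟩ʳ v)

  coreRanks leafRanks : List ℕ
  coreRanks = tabulate (rank ∘ (_↑ˡ 3))
  leafRanks = tabulate (rank ∘ (m ↑ʳ_))

  hitTime-edge : ∀ j S →
    hitTime H σ (edge j S) ≡ minOn S (pos H σ ∘ (_↑ˡ 3)) (suc (m + 3)) ⊓ pos H σ (m ↑ʳ j)
  hitTime-edge j S = begin
    hitTime H σ (edge j S)
      ≡⟨ hitTime≡minOn H σ (edge j S) ⟩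
    minOn (S ++ᵛ ⁅ j ⁆) (pos H σ) (suc (m + 3))
      ≡⟨ minOn-++ S ⁅ j ⁆ (pos H σ) (suc (m + 3)) ⟩
    minOn S (pos H σ ∘ (_↑ˡ 3)) (suc (m + 3)) ⊓ minOn ⁅ j ⁆ (pos H σ ∘ (m ↑ʳ_)) (suc (m + 3))
      ≡⟨ cong (_ ⊓_) (minOn-⁅⁆ j _ _ (m≤n⇒m≤1+n (pos≤nV H σ (m ↑ʳ j)))) ⟩
    minOn S (pos H σ ∘ (_↑ˡ 3)) (suc (m + 3)) ⊓ pos H σ (m ↑ʳ j) ∎
    where open ≡-Reasoning

  cost≡sublistMinSums : cost H σ ≡ sublistMinSums (map suc leafRanks) (map suc coreRanks)
  cost≡sublistMinSums = begin
    sum (map (hitTime H σ) (cartesianProductWith edge (allFin 3) (allSubsets m)))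
      ≡⟨ sum-map-cartesianProductWith (hitTime H σ) edge (allFin 3) (allSubsets m) ⟩
    sum (map (λ j → sum (map (hitTime H σ ∘ edge j) (allSubsets m))) (allFin 3))
      ≡⟨ cong sum (map-cong edgesThrough (allFin 3)) ⟩
    sublistMinSums (map suc leafRanks) (tabulate (pos H σ ∘ (_↑ˡ 3)))
      ≡⟨ cong (sublistMinSums (map suc leafRanks)) (map-tabulate (rank ∘ (_↑ˡ 3)) suc) ⟨
    sublistMinSums (map suc leafRanks) (map suc coreRanks) ∎
    where
    open ≡-Reasoning
    edgesThrough : ∀ j → sum (map (hitTime H σ ∘ edge j) (allSubsets m)) ≡
                         sublistMinSum (pos H σ (m ↑ʳ j)) (tabulate (pos H σ ∘ (_↑ˡ 3)))
    edgesThrough j = trans (cong sum (map-cong (hitTime-edge j) (allSubsets m)))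
                           (sum-minOn-allSubsets (pos H σ ∘ (_↑ˡ 3)) _ _ (m≤n⇒m≤1+n (pos≤nV H σ (m ↑ʳ j))))

  cost-lowerBound : 6 * 2 ^ m ≤ cost H σ
  cost-lowerBound = begin
    6 * 2 ^ m
      ≡⟨ cong (λ k → 6 * 2 ^ k) (length-tabulate (rank ∘ (_↑ˡ 3))) ⟨
    triangular (length leafRanks) * 2 ^ length coreRanks
      ≤⟨ sublistMinSums-lowerBound (m + 3) leafRanks coreRanks ≤-refl
           (subst (All (_< m + 3)) ranks-split (All.tabulate⁺ (λ v → toℕ<n (σ ⟨$⟩ʳ v))))
           (subst Unique ranks-split (Unique.tabulate⁺ (Injection.injective (↔⇒↣ σ) ∘ toℕ-injective))) ⟩
    sublistMinSums (map suc leafRanks) (map suc coreRanks)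
      ≡⟨ cost≡sublistMinSums ⟨
    cost H σ ∎
    where
    open ≤-Reasoning
    ranks-split : tabulate rank ≡ coreRanks ++ leafRanks
    ranks-split = tabulate-++ m rank

identity-optimal : ∀ m → IsMinSumSetCover (hypergraph m) Permutation.id
identity-optimal m σ = subst (_≤ cost (hypergraph m) σ) (sym identity-cost) (cost-lowerBound σ)
  where
  open ≡-Reasoning
  identity-cost : cost (hypergraph m) Permutation.id ≡ 6 * 2 ^ m
  identity-cost = begin
    cost (hypergraph m) Permutation.id
      ≡⟨ cost≡sublistMinSums {m} Permutation.id ⟩
    sublistMinSums (map suc (tabulate (toℕ ∘ (m ↑ʳ_)))) (map suc (tabulate {n = m} (toℕ ∘ (_↑ˡ 3))))
      ≡⟨ cong₂ (λ as qs → sublistMinSums (map suc as) (map suc qs))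
               (tabulate-cong {n = 3} (toℕ-↑ʳ m)) (tabulate-cong {n = m} (λ i → toℕ-↑ˡ i 3)) ⟩
    sublistMinSums (map suc (tabulate {n = 3} (λ j → m + toℕ j))) (map suc (tabulate {n = m} toℕ))
      ≡⟨ sublistMinSums-consecutive m ⟩
    6 * 2 ^ m ∎

identity-lastHit : ∀ m → nV (hypergraph m) ≤ maxHit (hypergraph m) Permutation.id
identity-lastHit m = begin
  m + 3
    ≡⟨ +-suc m 2 ⟩
  suc (m + 2)
    ≡⟨ cong suc (toℕ-↑ʳ m (fromℕ 2)) ⟨
  suc (toℕ (m ↑ʳ fromℕ 2))
    ≡⟨ m≥n⇒m⊓n≡n (m≤n⇒m≤1+n (pos≤nV H Permutation.id (m ↑ʳ fromℕ 2))) ⟨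
  suc (m + 3) ⊓ suc (toℕ (m ↑ʳ fromℕ 2))
    ≡⟨ cong (_⊓ suc (toℕ (m ↑ʳ fromℕ 2))) (minOn-⊥ m _ _) ⟨
  minOn ⊥ (pos H Permutation.id ∘ (_↑ˡ 3)) (suc (m + 3)) ⊓ pos H Permutation.id (m ↑ʳ fromℕ 2)
    ≡⟨ hitTime-edge Permutation.id (fromℕ 2) ⊥ ⟨
  hitTime H Permutation.id (edge (fromℕ 2) ⊥)
    ≤⟨ hitTime≤maxHit H Permutation.id (edge∈edges (fromℕ 2) ⊥) ⟩
  maxHit H Permutation.id ∎
  where
  open ≤-Reasoning
  H : Hypergraph
  H = hypergraph m

theorem2 : (n : ℕ) → 3 ≤ n → Σ Hypergraph (λ H → τ≡ H 3 × τ→≡ H n)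
theorem2 (suc (suc (suc m))) (s≤s (s≤s (s≤s z≤n))) =
  hypergraph m , τ≡3 m ,
  subst (τ→≡ (hypergraph m)) (+-comm m 3)
        (τ→≡nV (hypergraph m) Permutation.id (identity-optimal m) (identity-lastHit m))
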